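{- Let $q=2^m$ and let $O=\{y_1,\dots,y_{q+1}\}$ be an oval with points in $\mathbb{F}_{q^2}$ and nucleus at $0$, i.e. $O$ is a set of $q+1$ nonzero elements of $K=\mathbb{F}_{q^2}$ such that $O\cup\{0\}$ is a hyperoval. Then $O$ is a super-Vandermonde set, i.e. $$\sum_{i=1}^{q+1} y_i^k=0\quad\text{for all } 1\le k\le q.$$
   Context: Let $q=2^m$, $F=\mathbb{F}_q$, $K=\mathbb{F}_{q^2}$, and for $x\in K$ write $\bar x=x^q$. Let $S=\{u\in K: u^{q+1}=1\}$ and define the $F$-valued symmetric bilinear form $\langle x,y\rangle=x\bar y+\bar x y$ on $K$. The affine plane $AG(2,q)$ is identified with $K$: its points are the elements of $K$ and its lines are the sets $L(u,\mu)=\{x\in K:\langle u,x\rangle+\mu=0\}$ with $u\in S$, $\mu\in F$. A hyperoval (with points in $\mathbb{F}_{q^2}$) is a set of $q+2$ points of $K$, no three of which lie on a common line. A set $\{y_1,\dots,y_t\}$ is called a super-Vandermonde set if $\sum_i y_i^k=0$ for all $1\le k\le t-1$. -}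

module Defs where

open import Data.Nat as ℕ using (ℕ; zero; suc; _≤_)
open import Data.Fin as F using (Fin)
open import Data.List using (List; length)
open import Data.List.Membership.Propositional using (_∈_)
open import Data.List.Relation.Unary.Unique.Propositional using (Unique)
open import Data.Product using (Σ; ∃; ∃-syntax; _×_; _,_)
open import Relation.Nullary using (¬_)
open import Relation.Binary.Definitions using (DecidableEquality)
open import Relation.Binary.PropositionalEquality using (_≡_; _≢_)
open import Algebra.Structures using (IsCommutativeRing)

record FiniteField : Set₁ where
  field
    Carrier : Set
    _+_ _*_ : Carrier → Carrier → Carrier
    -_ : Carrier → Carrier
    0# 1# : Carrier
    isCommutativeRing : IsCommutativeRing _≡_ _+_ _*_ -_ 0# 1#
    0≢1 : 0# ≢ 1#
    inverse : ∀ x → x ≢ 0# → ∃[ y ] (x * y ≡ 1#)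
    _≟_ : DecidableEquality Carrier
    elements : List Carrier
    complete : ∀ x → x ∈ elements
    unique : Unique elements

  size : ℕ
  size = length elements

  infixr 8 _^_
  _^_ : Carrier → ℕ → Carrier
  x ^ zero = 1#
  x ^ suc n = x * (x ^ n)

  sumF : (n : ℕ) → (Fin n → Carrier) → Carrier
  sumF zero f = 0#
  sumF (suc n) f = f F.zero + sumF n (λ i → f (F.suc i))

-- Setting of the paper: q = 2^m and K = F_{q^2}.
module Plane (K : FiniteField) (q : ℕ) where
  open FiniteField K

  conj : Carrier → Carrier
  conj x = x ^ q

  -- F = F_q as the subfield {x : x^q = x}
  InF : Carrier → Set
  InF x = x ^ q ≡ x

  InS : Carrier → Set
  InS u = u ^ (suc q) ≡ 1#

  ⟨_,_⟩ : Carrier → Carrier → Carrier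
  ⟨ x , y ⟩ = (x * conj y) + (conj x * y)

  OnLine : Carrier → Carrier → Carrier → Set
  OnLine u μ x = (⟨ u , x ⟩ + μ) ≡ 0#

  Collinear : Carrier → Carrier → Carrier → Set
  Collinear a b c =
    ∃[ u ] ∃[ μ ] (InS u × InF μ × OnLine u μ a × OnLine u μ b × OnLine u μ c)

  IsHyperoval : (Fin (suc (suc q)) → Carrier) → Set
  IsHyperoval P =
    (∀ i j → P i ≡ P j → i ≡ j) ×
    (∀ i j k → i ≢ j → i ≢ k → j ≢ k → ¬ Collinear (P i) (P j) (P k))

  withNucleus : (Fin (suc q) → Carrier) → Fin (suc (suc q)) → Carrier
  withNucleus y F.zero = 0#
  withNucleus y (F.suc i) = y i

  IsOvalWithNucleus0 : (Fin (suc q) → Carrier) → Set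
  IsOvalWithNucleus0 y =
    (∀ i j → y i ≡ y j → i ≡ j) × (∀ i → y i ≢ 0#) × IsHyperoval (withNucleus y)

  IsSuperVandermonde : (n : ℕ) → (Fin n → Carrier) → Set
  IsSuperVandermonde n y =
    ∀ k → 1 ≤ k → suc k ≤ n → sumF n (λ i → y i ^ k) ≡ 0#

-- We prove more generally that every hyperoval H = {H₀, …, H_{q+1}} of the plane
-- K has vanishing power sums Σ_p H_p ^ k for k ≤ q; the lemma is the case
-- H = O ∪ {0}. The argument: for each u in the unit circle S, the lines with
-- normal direction u meet H in pairs of points {p, σ p} with ⟨ u , H p ⟩ =
-- ⟨ u , H (σ p) ⟩ (a line through a point of H that met H only once would give
-- q + 2 elements of S, but S has only q + 1). In characteristic two such paired
-- sums vanish, so the polynomial P(v) = Σ_p (H_p + H̄_p v) ^ k, which satisfies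
-- P(u²) = Σ_p (u ⟨ u , H p ⟩) ^ k, vanishes at the q + 1 distinct squares of the
-- directions of the chords through H₀. As deg P ≤ q, P = 0, and P(0) is the
-- power sum.

module Submission where

open import Defs
open import Level using (0ℓ)
open import Algebra.Bundles using (CommutativeRing)
import Data.Nat as ℕ
open ℕ using (ℕ; zero; suc; z≤n; s≤s)
import Data.Nat.Properties as ℕₚ
open import Data.Fin as Fin using (Fin)
import Data.Fin.Properties as Finₚ
import Data.Fin.Permutation as Perm
open import Data.List using (List; []; _∷_; length; map; filter; foldr)
import Data.List.Properties
open import Data.List.Membership.Propositional using (_∈_)
open import Data.List.Membership.Propositional.Properties
  using (∈-map⁺; ∈-map⁻; ∈-filter⁺; ∈-filter⁻)
open import Data.List.Membership.Propositional.Properties.WithK using (unique∧set⇒bag)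
open import Data.List.Relation.Unary.Any using (here; there)
open import Data.List.Relation.Unary.All as All using (All; []; _∷_)
open import Data.List.Relation.Unary.Unique.Propositional using (Unique)
open import Data.List.Relation.Unary.AllPairs using (_∷_)
import Data.List.Relation.Unary.Unique.Propositional.Properties as Uniqueₚ
open import Data.List.Relation.Binary.Permutation.Propositional using (_↭_; ↭⇒↭ₛ)
open import Data.List.Relation.Binary.Permutation.Propositional.Properties using (↭-length)
open import Data.List.Relation.Binary.Permutation.Setoid.Properties using (foldr-commMonoid)
open import Data.List.Relation.Binary.BagAndSetEquality using (∼bag⇒↭)
open import Data.Product using (Σ-syntax; _×_; _,_; proj₁; proj₂)
open import Data.Empty using (⊥-elim)
open import Function.Bundles using (_⇔_; mk⇔)
open import Function.Definitions using (Injective)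
open import Relation.Nullary using (¬_; yes; no)
open import Relation.Nullary.Negation using (contradiction)
open import Relation.Nullary.Decidable using (¬?; _×-dec_)
open import Function.Base using (_∘_)
open import Relation.Binary.PropositionalEquality

same-members⇒↭ : {A : Set} {xs ys : List A} → Unique xs → Unique ys →
  (∀ {z} → z ∈ xs ⇔ z ∈ ys) → xs ↭ ys
same-members⇒↭ uxs uys same = ∼bag⇒↭ (unique∧set⇒bag uxs uys same)

module FieldTheory (K : FiniteField) where

  open FiniteField K public
    using (Carrier; _≟_; 0≢1; inverse; elements; complete; unique; size; _^_; sumF)

  commutativeRing : CommutativeRing 0ℓ 0ℓ
  commutativeRing = record { isCommutativeRing = FiniteField.isCommutativeRing K }

  open CommutativeRing commutativeRing public
    using ( _+_; _*_; -_; 0#; 1#; +-assoc; +-comm; +-identityˡ; +-identityʳ; -‿inverseˡ; -‿inverseʳ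
          ; *-comm; *-identityˡ; *-identityʳ; zeroˡ; zeroʳ
          ; +-commutativeMonoid; *-isCommutativeMonoid; commutativeSemiring; ring )
  open import Algebra.Solver.Ring.NaturalCoefficients.Default commutativeSemiring public
  open import Algebra.Properties.Ring ring using (-1*x≈-x; -‿involutive; +-inverseˡ-unique)
  open import Algebra.Properties.CommutativeSemiring.Exp commutativeSemiring
    using (^-homo-*; ^-assocʳ; ^-distrib-*) renaming (_^_ to _^ˢ_)

  ^≡^ˢ : ∀ x n → x ^ n ≡ x ^ˢ n
  ^≡^ˢ x zero = refl
  ^≡^ˢ x (suc n) = cong (x *_) (^≡^ˢ x n)

  ^-+ : ∀ x a b → x ^ (a ℕ.+ b) ≡ x ^ a * x ^ b
  ^-+ x a b rewrite ^≡^ˢ x (a ℕ.+ b) | ^≡^ˢ x a | ^≡^ˢ x b = ^-homo-* x a b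

  ^-* : ∀ x a b → x ^ (a ℕ.* b) ≡ (x ^ a) ^ b
  ^-* x a b rewrite ^≡^ˢ x (a ℕ.* b) | ^≡^ˢ (x ^ a) b | ^≡^ˢ x a = sym (^-assocʳ x a b)

  *-^ : ∀ x y n → (x * y) ^ n ≡ x ^ n * y ^ n
  *-^ x y n rewrite ^≡^ˢ (x * y) n | ^≡^ˢ x n | ^≡^ˢ y n = ^-distrib-* x y n

  1-^ : ∀ n → 1# ^ n ≡ 1#
  1-^ zero = refl
  1-^ (suc n) = trans (*-identityˡ _) (1-^ n)

  _⁻¹[_] : (a : Carrier) → a ≢ 0# → Carrier
  a ⁻¹[ a≢0 ] = proj₁ (inverse a a≢0)

  *-inverse : ∀ {a} (a≢0 : a ≢ 0#) → a * a ⁻¹[ a≢0 ] ≡ 1#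
  *-inverse {a} a≢0 = proj₂ (inverse a a≢0)

  inverse-cancelsˡ : ∀ {a} (a≢0 : a ≢ 0#) x → a ⁻¹[ a≢0 ] * (a * x) ≡ x
  inverse-cancelsˡ {a} a≢0 x = begin
      a⁻¹ * (a * x)  ≡⟨ solve 3 (λ x a a⁻¹ → a⁻¹ :* (a :* x) := (a :* a⁻¹) :* x) refl x a a⁻¹ ⟩
      (a * a⁻¹) * x  ≡⟨ cong (_* x) (*-inverse a≢0) ⟩
      1# * x         ≡⟨ *-identityˡ x ⟩
      x              ∎
    where
      open ≡-Reasoning
      a⁻¹ : Carrier
      a⁻¹ = a ⁻¹[ a≢0 ]

  inverse-cancelsʳ : ∀ {a} (a≢0 : a ≢ 0#) x → a * (a ⁻¹[ a≢0 ] * x) ≡ x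
  inverse-cancelsʳ {a} a≢0 x =
    trans (solve 3 (λ x a a⁻¹ → a :* (a⁻¹ :* x) := a⁻¹ :* (a :* x)) refl x a (a ⁻¹[ a≢0 ]))
          (inverse-cancelsˡ a≢0 x)

  inverse-nonzero : ∀ {a} (a≢0 : a ≢ 0#) → a ⁻¹[ a≢0 ] ≢ 0#
  inverse-nonzero {a} a≢0 a⁻¹≡0 = 0≢1 (trans (sym (zeroʳ a)) (trans (cong (a *_) (sym a⁻¹≡0)) (*-inverse a≢0)))

  cancelˡ : ∀ {a x y} → a ≢ 0# → a * x ≡ a * y → x ≡ y
  cancelˡ {a} {x} {y} a≢0 ax≡ay = begin
      x                     ≡⟨ sym (inverse-cancelsˡ a≢0 x) ⟩
      a ⁻¹[ a≢0 ] * (a * x) ≡⟨ cong (a ⁻¹[ a≢0 ] *_) ax≡ay ⟩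
      a ⁻¹[ a≢0 ] * (a * y) ≡⟨ inverse-cancelsˡ a≢0 y ⟩
      y                     ∎
    where open ≡-Reasoning

  *-nonzero : ∀ {x y} → x ≢ 0# → y ≢ 0# → x * y ≢ 0#
  *-nonzero {x} {y} x≢0 y≢0 xy≡0 = y≢0 (cancelˡ x≢0 (trans xy≡0 (sym (zeroʳ x))))

  ^-nonzero : ∀ {x} n → x ≢ 0# → x ^ n ≢ 0#
  ^-nonzero zero x≢0 1≡0 = 0≢1 (sym 1≡0)
  ^-nonzero (suc n) x≢0 = *-nonzero x≢0 (^-nonzero n x≢0)

  size≢1 : size ≢ 1
  size≢1 size≡1 = 0≢1 (single-element elements size≡1 (complete 0#) (complete 1#))
    where
      single-element : ∀ xs → length xs ≡ 1 → ∀ {a b} → a ∈ xs → b ∈ xs → a ≡ b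
      single-element (x ∷ []) _ (here a≡x) (here b≡x) = trans a≡x (sym b≡x)

  difference-nonzero : ∀ {v a} → v ≢ a → v + - a ≢ 0#
  difference-nonzero {v} {a} v≢a v-a≡0 = v≢a (trans (+-inverseˡ-unique v (- a) v-a≡0) (-‿involutive a))

  -1≢0 : - 1# ≢ 0#
  -1≢0 -1≡0 = difference-nonzero 0≢1 (trans (+-identityˡ (- 1#)) -1≡0)

  -- Fermat's little theorem x ^ |K| = x, by the classical argument: multiplication
  -- by a nonzero x permutes the nonzero elements, so their product P satisfies
  -- x ^ (|K| - 1) * P = P.

  nonzeroElements : List Carrier
  nonzeroElements = filter (λ a → ¬? (a ≟ 0#)) elements

  ∈-nonzeroElements⁺ : ∀ {z} → z ≢ 0# → z ∈ nonzeroElements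
  ∈-nonzeroElements⁺ {z} = ∈-filter⁺ (λ a → ¬? (a ≟ 0#)) (complete z)

  ∈-nonzeroElements⁻ : ∀ {z} → z ∈ nonzeroElements → z ≢ 0#
  ∈-nonzeroElements⁻ z∈ = proj₂ (∈-filter⁻ (λ a → ¬? (a ≟ 0#)) {xs = elements} z∈)

  nonzeroElements-unique : Unique nonzeroElements
  nonzeroElements-unique = Uniqueₚ.filter⁺ (λ a → ¬? (a ≟ 0#)) unique

  size-nonzeroElements : size ≡ suc (length nonzeroElements)
  size-nonzeroElements =
    ↭-length (same-members⇒↭ unique unique-0∷nonzero (mk⇔ (λ _ → ∈-0∷nonzero _) (λ _ → complete _)))
    where
      unique-0∷nonzero : Unique (0# ∷ nonzeroElements)
      unique-0∷nonzero = All.tabulate (λ z∈ 0≡z → ∈-nonzeroElements⁻ z∈ (sym 0≡z)) ∷ nonzeroElements-unique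
      ∈-0∷nonzero : ∀ z → z ∈ 0# ∷ nonzeroElements
      ∈-0∷nonzero z with z ≟ 0#
      ... | yes z≡0 = here z≡0
      ... | no z≢0 = there (∈-nonzeroElements⁺ z≢0)

  scaling-permutes : ∀ {x} → x ≢ 0# → map (x *_) nonzeroElements ↭ nonzeroElements
  scaling-permutes {x} x≢0 =
    same-members⇒↭ (Uniqueₚ.map⁺ (cancelˡ x≢0) nonzeroElements-unique) nonzeroElements-unique
      (mk⇔ image-nonzero nonzero-image)
    where
      image-nonzero : ∀ {z} → z ∈ map (x *_) nonzeroElements → z ∈ nonzeroElements
      image-nonzero z∈ with ∈-map⁻ (x *_) z∈
      ... | a , a∈ , refl = ∈-nonzeroElements⁺ (*-nonzero x≢0 (∈-nonzeroElements⁻ a∈))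
      nonzero-image : ∀ {z} → z ∈ nonzeroElements → z ∈ map (x *_) nonzeroElements
      nonzero-image {z} z∈ =
        subst (_∈ map (x *_) nonzeroElements) (inverse-cancelsʳ x≢0 z)
          (∈-map⁺ (x *_) (∈-nonzeroElements⁺ (*-nonzero (inverse-nonzero x≢0) (∈-nonzeroElements⁻ z∈))))

  product : List Carrier → Carrier
  product = foldr _*_ 1#

  product-↭ : ∀ {xs ys} → xs ↭ ys → product xs ≡ product ys
  product-↭ xs↭ys = foldr-commMonoid (setoid Carrier) *-isCommutativeMonoid (↭⇒↭ₛ xs↭ys)

  product-scale : ∀ x xs → product (map (x *_) xs) ≡ x ^ length xs * product xs
  product-scale x [] = sym (*-identityˡ 1#)
  product-scale x (a ∷ xs) rewrite product-scale x xs =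
    solve 4 (λ x a xⁿ p → (x :* a) :* (xⁿ :* p) := (x :* xⁿ) :* (a :* p)) refl x a (x ^ length xs) (product xs)

  product-nonzero : ∀ {xs} → All (_≢ 0#) xs → product xs ≢ 0#
  product-nonzero [] 1≡0 = 0≢1 (sym 1≡0)
  product-nonzero (a≢0 ∷ as≢0) = *-nonzero a≢0 (product-nonzero as≢0)

  fermat : ∀ x → x ^ size ≡ x
  fermat x with x ≟ 0#
  ... | yes refl rewrite size-nonzeroElements = zeroˡ _
  ... | no x≢0 rewrite size-nonzeroElements = trans (cong (x *_) xⁿ≡1) (*-identityʳ x)
    where
      n = length nonzeroElements
      P = product nonzeroElements
      P≢0 : P ≢ 0#
      P≢0 = product-nonzero (All.tabulate ∈-nonzeroElements⁻)
      xⁿ≡1 : x ^ n ≡ 1#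
      xⁿ≡1 = cancelˡ P≢0 (begin
        P * x ^ n                        ≡⟨ *-comm P _ ⟩
        x ^ n * P                        ≡⟨ product-scale x nonzeroElements ⟨
        product (map (x *_) nonzeroElements) ≡⟨ product-↭ (scaling-permutes x≢0) ⟩
        P                                ≡⟨ *-identityʳ P ⟨
        P * 1#                           ∎)
        where open ≡-Reasoning

  -- A finite field of even order has characteristic two: by Fermat,
  -- -1 = (-1) ^ |K| = ((-1) ^ 2) ^ (|K| / 2) = 1.
  even-order⇒char2 : ∀ n → size ≡ 2 ℕ.* n → 1# + 1# ≡ 0#
  even-order⇒char2 n size≡2n = begin
      1# + 1#    ≡⟨ cong (1# +_) -1≡1 ⟨
      1# + - 1#  ≡⟨ -‿inverseʳ 1# ⟩
      0#         ∎
    where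
      open ≡-Reasoning
      [-1]²≡1 : (- 1#) ^ 2 ≡ 1#
      [-1]²≡1 = begin
        - 1# * (- 1# * 1#)  ≡⟨ cong (- 1# *_) (*-identityʳ (- 1#)) ⟩
        - 1# * - 1#         ≡⟨ -1*x≈-x (- 1#) ⟩
        - (- 1#)            ≡⟨ -‿involutive 1# ⟩
        1#                  ∎
      -1≡1 : - 1# ≡ 1#
      -1≡1 = begin
        - 1#                ≡⟨ fermat (- 1#) ⟨
        (- 1#) ^ size       ≡⟨ cong ((- 1#) ^_) size≡2n ⟩
        (- 1#) ^ (2 ℕ.* n)  ≡⟨ ^-* (- 1#) 2 n ⟩
        ((- 1#) ^ 2) ^ n    ≡⟨ cong (_^ n) [-1]²≡1 ⟩
        1# ^ n              ≡⟨ 1-^ n ⟩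
        1#                  ∎

  -- Sums over Fin n as in Defs agree with the library's sums over vectors,
  -- which come with reindexing and linearity lemmas.
  open import Algebra.Properties.CommutativeMonoid.Sum +-commutativeMonoid
    using (sum; sum-cong-≗; ∑-distrib-+; sum-permute)

  sumF≡sum : ∀ n f → sumF n f ≡ sum f
  sumF≡sum zero f = refl
  sumF≡sum (suc n) f = cong (f Fin.zero +_) (sumF≡sum n (λ i → f (Fin.suc i)))

  sumF-cong : ∀ {n f g} → (∀ i → f i ≡ g i) → sumF n f ≡ sumF n g
  sumF-cong {n} {f} {g} f≗g = trans (sumF≡sum n f) (trans (sum-cong-≗ f≗g) (sym (sumF≡sum n g)))

  module Characteristic2 (char2 : 1# + 1# ≡ 0#) where

    x+x≡0 : ∀ x → x + x ≡ 0#
    x+x≡0 x = begin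
        x + x            ≡⟨ solve 1 (λ x → x :+ x := (con 1 :+ con 1) :* x) refl x ⟩
        (1# + 1#) * x    ≡⟨ cong (_* x) char2 ⟩
        0# * x           ≡⟨ zeroˡ x ⟩
        0#               ∎
      where open ≡-Reasoning

    -- Every element is its own negative, so a + b = 0 means a = b.
    sum≡0⇒≡ : ∀ {a b} → a + b ≡ 0# → a ≡ b
    sum≡0⇒≡ {a} {b} a+b≡0 = begin
        a              ≡⟨ +-identityʳ a ⟨
        a + 0#         ≡⟨ cong (a +_) (x+x≡0 b) ⟨
        a + (b + b)    ≡⟨ +-assoc a b b ⟨
        (a + b) + b    ≡⟨ cong (_+ b) a+b≡0 ⟩
        0# + b         ≡⟨ +-identityˡ b ⟩
        b              ∎
      where open ≡-Reasoning

    square-+ : ∀ x y → (x + y) ^ 2 ≡ x ^ 2 + y ^ 2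
    square-+ x y = begin
        (x + y) ^ 2                        ≡⟨ solve 2 (λ x y → (x :+ y) :* ((x :+ y) :* con 1)
                                                 := (x :* (x :* con 1) :+ y :* (y :* con 1)) :+ (x :* y :+ x :* y))
                                                 refl x y ⟩
        (x ^ 2 + y ^ 2) + (x * y + x * y)  ≡⟨ cong ((x ^ 2 + y ^ 2) +_) (x+x≡0 (x * y)) ⟩
        (x ^ 2 + y ^ 2) + 0#               ≡⟨ +-identityʳ _ ⟩
        x ^ 2 + y ^ 2                      ∎
      where open ≡-Reasoning

    frobenius : ∀ n x y → (x + y) ^ (2 ℕ.^ n) ≡ x ^ (2 ℕ.^ n) + y ^ (2 ℕ.^ n)
    frobenius zero x y = begin
        (x + y) * 1#        ≡⟨ *-identityʳ (x + y) ⟩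
        x + y               ≡⟨ cong₂ _+_ (*-identityʳ x) (*-identityʳ y) ⟨
        x * 1# + y * 1#     ∎
      where open ≡-Reasoning
    frobenius (suc n) x y = begin
        (x + y) ^ (2 ℕ.* 2ⁿ)           ≡⟨ ^-* (x + y) 2 2ⁿ ⟩
        ((x + y) ^ 2) ^ 2ⁿ             ≡⟨ cong (_^ 2ⁿ) (square-+ x y) ⟩
        (x ^ 2 + y ^ 2) ^ 2ⁿ           ≡⟨ frobenius n (x ^ 2) (y ^ 2) ⟩
        (x ^ 2) ^ 2ⁿ + (y ^ 2) ^ 2ⁿ    ≡⟨ cong₂ _+_ (^-* x 2 2ⁿ) (^-* y 2 2ⁿ) ⟨
        x ^ (2 ℕ.* 2ⁿ) + y ^ (2 ℕ.* 2ⁿ) ∎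
      where
        open ≡-Reasoning
        2ⁿ = 2 ℕ.^ n

    -- Squaring is injective: a ^ 2 = b ^ 2 gives (a + b) ^ 2 = 0, so a + b = 0.
    square-injective : ∀ {a b} → a ^ 2 ≡ b ^ 2 → a ≡ b
    square-injective {a} {b} a²≡b² with (a + b) ≟ 0#
    ... | yes a+b≡0 = sum≡0⇒≡ a+b≡0
    ... | no a+b≢0 = contradiction [a+b]²≡0 (^-nonzero 2 a+b≢0)
      where
        [a+b]²≡0 : (a + b) ^ 2 ≡ 0#
        [a+b]²≡0 = trans (square-+ a b) (trans (cong (_+ b ^ 2) a²≡b²) (x+x≡0 (b ^ 2)))

    -- A sum invariant under a fixed-point-free involution σ vanishes: choosing
    -- one term c from each orbit {i, σ i}, the sum is Σ c + Σ (c ∘ σ) = 2 Σ c.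
    involution-sum : ∀ n (g : Fin n → Carrier) (σ : Fin n → Fin n) →
      (∀ i → σ (σ i) ≡ i) → (∀ i → σ i ≢ i) → (∀ i → g (σ i) ≡ g i) → sumF n g ≡ 0#
    involution-sum n g σ σσ≡id no-fixpoint g∘σ≡g = begin
        sumF n g                   ≡⟨ sumF≡sum n g ⟩
        sum g                      ≡⟨ sum-cong-≗ split ⟩
        sum (λ i → c i + c (σ i))  ≡⟨ ∑-distrib-+ c (λ i → c (σ i)) ⟩
        sum c + sum (λ i → c (σ i)) ≡⟨ cong (sum c +_) (sum-permute c π) ⟨
        sum c + sum c              ≡⟨ x+x≡0 (sum c) ⟩
        0#                         ∎
      where
        open ≡-Reasoning
        π = Perm.permutation σ σ σσ≡id σσ≡id
        c : Fin n → Carrier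
        c i with i Fin.<? σ i
        ... | yes _ = g i
        ... | no _ = 0#
        split : ∀ i → g i ≡ c i + c (σ i)
        split i with i Fin.<? σ i | σ i Fin.<? σ (σ i)
        ... | yes i<σi | yes σi<σσi = contradiction (subst (σ i Fin.<_) (σσ≡id i) σi<σσi) (Finₚ.<-asym i<σi)
        ... | yes _ | no _ = sym (+-identityʳ (g i))
        ... | no _ | yes _ = trans (sym (g∘σ≡g i)) (sym (+-identityˡ (g (σ i))))
        ... | no i≮σi | no σi≮σσi = contradiction i<σi i≮σi
          where
            i<σi : i Fin.< σ i
            i<σi = Finₚ.≤∧≢⇒< (ℕₚ.≮⇒≥ (subst (λ j → ¬ σ i Fin.< j) (σσ≡id i) σi≮σσi))
                               (λ i≡σi → no-fixpoint i (sym i≡σi))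

module Polynomials (K : FiniteField) where

  open FieldTheory K

  -- Polynomials as coefficient lists, constant term first, evaluated by Horner's rule.
  eval : List Carrier → Carrier → Carrier
  eval [] v = 0#
  eval (c ∷ cs) v = c + v * eval cs v

  -- f is a polynomial function given by at most n coefficients (degree < n).
  PolyFun : ℕ → (Carrier → Carrier) → Set
  PolyFun n f = Σ[ p ∈ List Carrier ] length p ℕ.≤ n × (∀ v → eval p v ≡ f v)

  polyFun-cong : ∀ {n f g} → (∀ v → f v ≡ g v) → PolyFun n f → PolyFun n g
  polyFun-cong f≡g (p , len , eval≡f) = p , len , (λ v → trans (eval≡f v) (f≡g v))

  polyFun-weaken : ∀ {m n f} → m ℕ.≤ n → PolyFun m f → PolyFun n f
  polyFun-weaken m≤n (p , len , eval≡f) = p , ℕₚ.≤-trans len m≤n , eval≡f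

  polyFun-zero : ∀ {n} → PolyFun n (λ _ → 0#)
  polyFun-zero = [] , z≤n , (λ _ → refl)

  addP : List Carrier → List Carrier → List Carrier
  addP [] q = q
  addP (a ∷ p) [] = a ∷ p
  addP (a ∷ p) (b ∷ q) = (a + b) ∷ addP p q

  eval-addP : ∀ p q v → eval (addP p q) v ≡ eval p v + eval q v
  eval-addP [] q v = sym (+-identityˡ _)
  eval-addP (a ∷ p) [] v = sym (+-identityʳ _)
  eval-addP (a ∷ p) (b ∷ q) v rewrite eval-addP p q v =
    solve 5 (λ a b v x y → (a :+ b) :+ v :* (x :+ y) := (a :+ v :* x) :+ (b :+ v :* y)) refl a b v (eval p v) (eval q v)

  length-addP : ∀ {n} p q → length p ℕ.≤ n → length q ℕ.≤ n → length (addP p q) ℕ.≤ n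
  length-addP [] q _ len-q = len-q
  length-addP (a ∷ p) [] len-p _ = len-p
  length-addP (a ∷ p) (b ∷ q) (s≤s len-p) (s≤s len-q) = s≤s (length-addP p q len-p len-q)

  polyFun-+ : ∀ {n f g} → PolyFun n f → PolyFun n g → PolyFun n (λ v → f v + g v)
  polyFun-+ (p , len-p , eval≡f) (q , len-q , eval≡g) =
    addP p q , length-addP p q len-p len-q , (λ v → trans (eval-addP p q v) (cong₂ _+_ (eval≡f v) (eval≡g v)))

  polyFun-sum : ∀ {n} N (f : Fin N → Carrier → Carrier) →
    (∀ i → PolyFun n (f i)) → PolyFun n (λ v → sumF N (λ i → f i v))
  polyFun-sum zero f _ = polyFun-zero
  polyFun-sum (suc N) f pf = polyFun-+ (pf Fin.zero) (polyFun-sum N (λ i → f (Fin.suc i)) (λ i → pf (Fin.suc i)))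

  eval-scale : ∀ c p v → eval (map (c *_) p) v ≡ c * eval p v
  eval-scale c [] v = sym (zeroʳ c)
  eval-scale c (a ∷ p) v rewrite eval-scale c p v =
    solve 4 (λ c a v x → c :* a :+ v :* (c :* x) := c :* (a :+ v :* x)) refl c a v (eval p v)

  polyFun-linear* : ∀ {n f} a b → PolyFun n f → PolyFun (suc n) (λ v → (b + a * v) * f v)
  polyFun-linear* {n} {f} a b (p , len , eval≡f) = addP bp (0# ∷ ap) , length-addP bp (0# ∷ ap) len-bp len-ap , eval≡
    where
      bp = map (b *_) p
      ap = map (a *_) p
      len-bp : length bp ℕ.≤ suc n
      len-bp = ℕₚ.m≤n⇒m≤1+n (subst (ℕ._≤ n) (sym (Data.List.Properties.length-map (b *_) p)) len)
      len-ap : length (0# ∷ ap) ℕ.≤ suc n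
      len-ap = s≤s (subst (ℕ._≤ n) (sym (Data.List.Properties.length-map (a *_) p)) len)
      eval≡ : ∀ v → eval (addP bp (0# ∷ ap)) v ≡ (b + a * v) * f v
      eval≡ v = begin
        eval (addP bp (0# ∷ ap)) v           ≡⟨ eval-addP bp (0# ∷ ap) v ⟩
        eval bp v + (0# + v * eval ap v)     ≡⟨ cong₂ (λ x y → x + (0# + v * y)) (eval-scale b p v) (eval-scale a p v) ⟩
        b * eval p v + (0# + v * (a * eval p v)) ≡⟨ cong (λ x → b * x + (0# + v * (a * x))) (eval≡f v) ⟩
        b * f v + (0# + v * (a * f v))       ≡⟨ solve 4 (λ a b v x → b :* x :+ (con 0 :+ v :* (a :* x)) := (b :+ a :* v) :* x)
                                                  refl a b v (f v) ⟩
        (b + a * v) * f v                    ∎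
        where open ≡-Reasoning

  polyFun-^ : ∀ a b k → PolyFun (suc k) (λ v → (b + a * v) ^ k)
  polyFun-^ a b zero = 1# ∷ [] , s≤s z≤n , (λ v → trans (cong (1# +_) (zeroʳ v)) (+-identityʳ 1#))
  polyFun-^ a b (suc k) = polyFun-linear* a b (polyFun-^ a b k)

  quotient : Carrier → List Carrier → List Carrier
  quotient a [] = []
  quotient a (c ∷ []) = []
  quotient a (c ∷ cs@(_ ∷ _)) = eval cs a ∷ quotient a cs

  length-quotient : ∀ {n} a p → length p ℕ.≤ suc n → length (quotient a p) ℕ.≤ n
  length-quotient a [] _ = z≤n
  length-quotient a (c ∷ []) _ = z≤n
  length-quotient {suc n} a (c ∷ cs@(_ ∷ _)) (s≤s len) = s≤s (length-quotient a cs len)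

  minus-cancels : ∀ v a x → (v + - a) * x + a * x ≡ v * x
  minus-cancels v a x = begin
      (v + - a) * x + a * x  ≡⟨ solve 4 (λ v na a x → (v :+ na) :* x :+ a :* x := v :* x :+ (na :+ a) :* x) refl v (- a) a x ⟩
      v * x + (- a + a) * x  ≡⟨ cong (λ y → v * x + y * x) (-‿inverseˡ a) ⟩
      v * x + 0# * x         ≡⟨ cong (v * x +_) (zeroˡ x) ⟩
      v * x + 0#             ≡⟨ +-identityʳ (v * x) ⟩
      v * x                  ∎
    where open ≡-Reasoning

  division : ∀ a p v → eval p v ≡ (v + - a) * eval (quotient a p) v + eval p a
  division a [] v = sym (trans (cong (_+ 0#) (zeroʳ (v + - a))) (+-identityʳ 0#))
  division a (c ∷ []) v = begin
      c + v * 0#                 ≡⟨ cong (c +_) (trans (zeroʳ v) (sym (zeroʳ a))) ⟩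
      c + a * 0#                 ≡⟨ +-identityˡ _ ⟨
      0# + (c + a * 0#)          ≡⟨ cong (_+ (c + a * 0#)) (zeroʳ (v + - a)) ⟨
      (v + - a) * 0# + (c + a * 0#) ∎
    where open ≡-Reasoning
  division a (c ∷ cs@(_ ∷ _)) v = begin
      c + v * P v                      ≡⟨ cong (λ x → c + v * x) (division a cs v) ⟩
      c + v * (d * R + P a)            ≡⟨ solve 5 (λ c v d R Pa → c :+ v :* (d :* R :+ Pa)
                                                                := d :* (v :* R) :+ (v :* Pa :+ c))
                                            refl c v d R (P a) ⟩
      d * (v * R) + (v * P a + c)      ≡⟨ cong (λ x → d * (v * R) + (x + c)) (minus-cancels v a (P a)) ⟨
      d * (v * R) + ((d * P a + a * P a) + c)
                                       ≡⟨ solve 5 (λ c d vR Pa aPa → d :* vR :+ ((d :* Pa :+ aPa) :+ c)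
                                                                  := d :* (Pa :+ vR) :+ (c :+ aPa))
                                            refl c d (v * R) (P a) (a * P a) ⟩
      d * (P a + v * R) + (c + a * P a) ∎
    where
      open ≡-Reasoning
      d = v + - a
      P = eval cs
      R = eval (quotient a cs) v

  factor-theorem : ∀ {n f} → PolyFun (suc n) f → ∀ a →
    Σ[ g ∈ (Carrier → Carrier) ] PolyFun n g × (∀ v → f v ≡ (v + - a) * g v + f a)
  factor-theorem {f = f} (p , len , eval≡f) a =
    eval (quotient a p) , (quotient a p , length-quotient a p len , λ _ → refl) , f≡
    where
      f≡ : ∀ v → f v ≡ (v + - a) * eval (quotient a p) v + f a
      f≡ v = trans (sym (eval≡f v)) (trans (division a p v) (cong (_ +_) (eval≡f a)))

  root-bound : ∀ n {f} → PolyFun n f → (w : Fin n → Carrier) → Injective _≡_ _≡_ w →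
    (∀ i → f (w i) ≡ 0#) → ∀ v → f v ≡ 0#
  root-bound zero ([] , _ , eval≡f) w _ _ v = sym (eval≡f v)
  root-bound (suc n) {f} pf w w-injective w-roots v with factor-theorem pf (w Fin.zero)
  ... | g , pg , f≡ = begin
      f v                        ≡⟨ f≡ v ⟩
      (v + - a) * g v + f a      ≡⟨ cong₂ (λ x y → (v + - a) * x + y) (g≡0 v) (w-roots Fin.zero) ⟩
      (v + - a) * 0# + 0#        ≡⟨ +-identityʳ _ ⟩
      (v + - a) * 0#             ≡⟨ zeroʳ _ ⟩
      0#                         ∎
    where
      open ≡-Reasoning
      a = w Fin.zero
      g-roots : ∀ i → g (w (Fin.suc i)) ≡ 0#
      g-roots i = cancelˡ (difference-nonzero (λ wᵢ≡a → Finₚ.0≢1+n (sym (w-injective wᵢ≡a)))) (begin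
        (b + - a) * g b            ≡⟨ +-identityʳ _ ⟨
        (b + - a) * g b + 0#       ≡⟨ cong ((b + - a) * g b +_) (w-roots Fin.zero) ⟨
        (b + - a) * g b + f a      ≡⟨ f≡ b ⟨
        f b                        ≡⟨ w-roots (Fin.suc i) ⟩
        0#                         ≡⟨ zeroʳ _ ⟨
        (b + - a) * 0#             ∎)
        where b = w (Fin.suc i)
      g≡0 : ∀ v → g v ≡ 0#
      g≡0 = root-bound n pg (λ i → w (Fin.suc i)) (λ wᵢ≡wⱼ → Finₚ.suc-injective (w-injective wᵢ≡wⱼ)) g-roots

  -- In a field there are at most n solutions of x ^ n = 1 (n ≥ 1): otherwise the
  -- polynomial -1 + x ^ n would vanish identically, yet it is -1 at 0.
  roots-of-unity-bound : ∀ n (w : Fin (suc (suc n)) → Carrier) → Injective _≡_ _≡_ w →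
    ¬ (∀ i → w i ^ suc n ≡ 1#)
  roots-of-unity-bound n w w-injective w-roots = -1≢0 (begin
      - 1#                   ≡⟨ +-identityʳ _ ⟨
      - 1# + 0#              ≡⟨ cong (- 1# +_) (zeroˡ _) ⟨
      - 1# + 0# ^ suc n      ≡⟨ root-bound (suc (suc n)) -1+xⁿ w w-injective roots 0# ⟩
      0#                     ∎)
    where
      open ≡-Reasoning
      constant : PolyFun (suc (suc n)) (λ _ → - 1#)
      constant = - 1# ∷ [] , s≤s z≤n , λ v → trans (cong (- 1# +_) (zeroʳ v)) (+-identityʳ _)
      power : PolyFun (suc (suc n)) (λ v → v ^ suc n)
      power = polyFun-cong (λ v → cong (_^ suc n) (trans (+-identityˡ _) (*-identityˡ v))) (polyFun-^ 1# 0# (suc n))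
      -1+xⁿ : PolyFun (suc (suc n)) (λ v → - 1# + v ^ suc n)
      -1+xⁿ = polyFun-+ constant power
      roots : ∀ i → - 1# + w i ^ suc n ≡ 0#
      roots i = trans (cong (- 1# +_) (w-roots i)) (-‿inverseˡ 1#)

module UnitaryPlane (K : FiniteField) (m : ℕ)
  (size≡q² : FiniteField.size K ≡ 2 ℕ.^ suc m ℕ.* 2 ℕ.^ suc m) where

  open FieldTheory K
  open Polynomials K

  h q : ℕ
  h = 2 ℕ.^ m
  q = 2 ℕ.^ suc m

  open Plane K q

  -- |K| = q² is even.
  char2 : 1# + 1# ≡ 0#
  char2 = even-order⇒char2 (h ℕ.* q) (trans size≡q² (ℕₚ.*-assoc 2 h q))

  open Characteristic2 char2

  conj-+ : ∀ x y → conj (x + y) ≡ conj x + conj y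
  conj-+ = frobenius (suc m)

  conj-* : ∀ x y → conj (x * y) ≡ conj x * conj y
  conj-* x y = *-^ x y q

  conj-involutive : ∀ x → conj (conj x) ≡ x
  conj-involutive x = trans (sym (^-* x q q)) (trans (cong (x ^_) (sym size≡q²)) (fermat x))

  ⟨⟩-+ : ∀ u a b → ⟨ u , a + b ⟩ ≡ ⟨ u , a ⟩ + ⟨ u , b ⟩
  ⟨⟩-+ u a b rewrite conj-+ a b =
    solve 6 (λ u a b ū ā b̄ → u :* (ā :+ b̄) :+ ū :* (a :+ b) := (u :* ā :+ ū :* a) :+ (u :* b̄ :+ ū :* b))
      refl u a b (conj u) (conj a) (conj b)

  ⟨⟩-inF : ∀ u x → InF ⟨ u , x ⟩
  ⟨⟩-inF u x rewrite conj-+ (u * conj x) (conj u * x) | conj-* u (conj x) | conj-* (conj u) x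
                   | conj-involutive x | conj-involutive u = +-comm _ _

  collinear-by-direction : ∀ {u a b c} → InS u → ⟨ u , a + b ⟩ ≡ 0# → ⟨ u , a + c ⟩ ≡ 0# → Collinear a b c
  collinear-by-direction {u} {a} {b} {c} u∈S ab≡0 ac≡0 =
    u , ⟨ u , a ⟩ , u∈S , ⟨⟩-inF u a , x+x≡0 ⟨ u , a ⟩ , through b ab≡0 , through c ac≡0
    where
      through : ∀ x → ⟨ u , a + x ⟩ ≡ 0# → ⟨ u , x ⟩ + ⟨ u , a ⟩ ≡ 0#
      through x ax≡0 = trans (+-comm _ _) (trans (sym (⟨⟩-+ u a x)) ax≡0)

  square-root-inF : ∀ {N} → InF N → InF (N ^ h) × N ^ h * N ^ h ≡ N
  square-root-inF {N} N∈F = s∈F , s*s≡N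
    where
      s∈F : InF (N ^ h)
      s∈F = begin
        (N ^ h) ^ q    ≡⟨ ^-* N h q ⟨
        N ^ (h ℕ.* q)  ≡⟨ cong (N ^_) (ℕₚ.*-comm h q) ⟩
        N ^ (q ℕ.* h)  ≡⟨ ^-* N q h ⟩
        (N ^ q) ^ h    ≡⟨ cong (_^ h) N∈F ⟩
        N ^ h          ∎
        where open ≡-Reasoning
      s*s≡N : N ^ h * N ^ h ≡ N
      s*s≡N = begin
        N ^ h * N ^ h  ≡⟨ ^-+ N h h ⟨
        N ^ (h ℕ.+ h)  ≡⟨ cong (λ e → N ^ (h ℕ.+ e)) (ℕₚ.+-identityʳ h) ⟨
        N ^ q          ≡⟨ N∈F ⟩
        N              ∎
        where open ≡-Reasoning

  inverse-inF : ∀ {s} (s≢0 : s ≢ 0#) → InF s → InF (s ⁻¹[ s≢0 ])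
  inverse-inF {s} s≢0 s∈F = cancelˡ s≢0 (begin
      s * conj t       ≡⟨ cong (_* conj t) s∈F ⟨
      conj s * conj t  ≡⟨ conj-* s t ⟨
      conj (s * t)     ≡⟨ cong conj (*-inverse s≢0) ⟩
      conj 1#          ≡⟨ 1-^ q ⟩
      1#               ≡⟨ *-inverse s≢0 ⟨
      s * t            ∎)
    where
      open ≡-Reasoning
      t = s ⁻¹[ s≢0 ]

  -- Every nonzero x is orthogonal to some u ∈ S, namely u = x / √(x x̄).
  direction : ∀ x → x ≢ 0# → Σ[ u ∈ Carrier ] InS u × ⟨ u , x ⟩ ≡ 0#
  direction x x≢0 = x * t , u∈S , ⟨u,x⟩≡0
    where
      N = x * conj x
      N∈F : InF N
      N∈F = trans (conj-* x (conj x)) (trans (cong (conj x *_) (conj-involutive x)) (*-comm (conj x) x))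
      s = N ^ h
      s≢0 : s ≢ 0#
      s≢0 = ^-nonzero h (*-nonzero x≢0 (^-nonzero q x≢0))
      t = s ⁻¹[ s≢0 ]
      conj-u : conj (x * t) ≡ conj x * t
      conj-u = trans (conj-* x t) (cong (conj x *_) (inverse-inF s≢0 (proj₁ (square-root-inF N∈F))))
      u∈S : InS (x * t)
      u∈S = begin
        (x * t) * conj (x * t)    ≡⟨ cong ((x * t) *_) conj-u ⟩
        (x * t) * (conj x * t)    ≡⟨ solve 3 (λ x t x̄ → (x :* t) :* (x̄ :* t) := (x :* x̄) :* (t :* t)) refl x t (conj x) ⟩
        N * (t * t)               ≡⟨ cong (_* (t * t)) (proj₂ (square-root-inF N∈F)) ⟨
        (s * s) * (t * t)         ≡⟨ solve 2 (λ s t → (s :* s) :* (t :* t) := (s :* t) :* (s :* t)) refl s t ⟩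
        (s * t) * (s * t)         ≡⟨ cong₂ _*_ (*-inverse s≢0) (*-inverse s≢0) ⟩
        1# * 1#                   ≡⟨ *-identityˡ 1# ⟩
        1#                        ∎
        where open ≡-Reasoning
      ⟨u,x⟩≡0 : ⟨ x * t , x ⟩ ≡ 0#
      ⟨u,x⟩≡0 = begin
        (x * t) * conj x + conj (x * t) * x   ≡⟨ cong (λ y → (x * t) * conj x + y * x) conj-u ⟩
        (x * t) * conj x + (conj x * t) * x   ≡⟨ cong ((x * t) * conj x +_)
                                                   (solve 3 (λ x t x̄ → (x̄ :* t) :* x := (x :* t) :* x̄) refl x t (conj x)) ⟩
        (x * t) * conj x + (x * t) * conj x   ≡⟨ x+x≡0 _ ⟩
        0#                                    ∎
        where open ≡-Reasoning

  S-form : ∀ {u} x → InS u → u * ⟨ u , x ⟩ ≡ x + u ^ 2 * conj x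
  S-form {u} x u∈S = begin
      u * (u * conj x + conj u * x)   ≡⟨ solve 4 (λ u ū x x̄ → u :* (u :* x̄ :+ ū :* x)
                                                              := (u :* ū) :* x :+ (u :* (u :* con 1)) :* x̄)
                                           refl u (conj u) x (conj x) ⟩
      (u * conj u) * x + u ^ 2 * conj x ≡⟨ cong (λ y → y * x + u ^ 2 * conj x) u∈S ⟩
      1# * x + u ^ 2 * conj x         ≡⟨ cong (_+ u ^ 2 * conj x) (*-identityˡ x) ⟩
      x + u ^ 2 * conj x              ∎
    where open ≡-Reasoning

  S-bound : (w : Fin (suc (suc q)) → Carrier) → Injective _≡_ _≡_ w → ¬ (∀ i → InS (w i))
  S-bound = roots-of-unity-bound q

  module Hyperoval (H : Fin (suc (suc q)) → Carrier) (hyperoval : IsHyperoval H) where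

    H-injective : ∀ i j → H i ≡ H j → i ≡ j
    H-injective = proj₁ hyperoval

    chord-nonzero : ∀ {i j} → i ≢ j → H i + H j ≢ 0#
    chord-nonzero {i} {j} i≢j Hi+Hj≡0 = i≢j (H-injective i j (sum≡0⇒≡ Hi+Hj≡0))

    -- Joins u p j: the line through H p with normal direction u contains H j.
    Joins : Carrier → Fin (suc (suc q)) → Fin (suc (suc q)) → Set
    Joins u p j = ⟨ u , H p + H j ⟩ ≡ 0#

    joins-unique : ∀ {u p j k} → InS u → j ≢ p → k ≢ p → Joins u p j → Joins u p k → j ≡ k
    joins-unique {u} {p} {j} {k} u∈S j≢p k≢p p~j p~k with j Fin.≟ k
    ... | yes j≡k = j≡k
    ... | no j≢k = ⊥-elim (proj₂ hyperoval p j k (≢-sym j≢p) (≢-sym k≢p) j≢k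
                                  (collinear-by-direction u∈S p~j p~k))

    chord-direction : ∀ p j → j ≢ p → Carrier
    chord-direction p j j≢p = proj₁ (direction (H p + H j) (chord-nonzero (≢-sym j≢p)))

    chord-direction∈S : ∀ p j (j≢p : j ≢ p) → InS (chord-direction p j j≢p)
    chord-direction∈S p j j≢p = proj₁ (proj₂ (direction (H p + H j) (chord-nonzero (≢-sym j≢p))))

    chord-direction-joins : ∀ p j (j≢p : j ≢ p) → Joins (chord-direction p j j≢p) p j
    chord-direction-joins p j j≢p = proj₂ (proj₂ (direction (H p + H j) (chord-nonzero (≢-sym j≢p))))

    -- Every line through a point of the hyperoval is a secant: otherwise u and
    -- the q + 1 distinct chord directions at H p would be q + 2 elements of S.
    secant : ∀ {u} → InS u → ∀ p → Σ[ j ∈ Fin (suc (suc q)) ] j ≢ p × Joins u p j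
    secant {u} u∈S p with Finₚ.any? (λ j → ¬? (j Fin.≟ p) ×-dec (⟨ u , H p + H j ⟩ ≟ 0#))
    ... | yes found = found
    ... | no none = ⊥-elim (S-bound w w-injective w∈S)
      where
        other : Fin (suc q) → Fin (suc (suc q))
        other = Fin.punchIn p
        other≢p : ∀ i → other i ≢ p
        other≢p = Finₚ.punchInᵢ≢i p
        d : Fin (suc q) → Carrier
        d i = chord-direction p (other i) (other≢p i)
        w : Fin (suc (suc q)) → Carrier
        w Fin.zero = u
        w (Fin.suc i) = d i
        w∈S : ∀ i → InS (w i)
        w∈S Fin.zero = u∈S
        w∈S (Fin.suc i) = chord-direction∈S p (other i) (other≢p i)
        d-joins : ∀ {v} i → d i ≡ v → Joins v p (other i)
        d-joins i refl = chord-direction-joins p (other i) (other≢p i)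
        w-injective : Injective _≡_ _≡_ w
        w-injective {Fin.zero} {Fin.zero} _ = refl
        w-injective {Fin.zero} {Fin.suc i} u≡dᵢ = ⊥-elim (none (other i , other≢p i , d-joins i (sym u≡dᵢ)))
        w-injective {Fin.suc i} {Fin.zero} dᵢ≡u = ⊥-elim (none (other i , other≢p i , d-joins i dᵢ≡u))
        w-injective {Fin.suc i} {Fin.suc j} dᵢ≡dⱼ = cong Fin.suc (Finₚ.punchIn-injective p i j
          (joins-unique (w∈S (Fin.suc i)) (other≢p i) (other≢p j) (d-joins i refl) (d-joins j (sym dᵢ≡dⱼ))))

    -- For u ∈ S the lines with direction u pair off the points of the
    -- hyperoval: σ p is the second point on the line through H p.
    module Pairing {u} (u∈S : InS u) where

      σ : Fin (suc (suc q)) → Fin (suc (suc q))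
      σ p = proj₁ (secant u∈S p)

      σ-moves : ∀ p → σ p ≢ p
      σ-moves p = proj₁ (proj₂ (secant u∈S p))

      σ-joins : ∀ p → Joins u p (σ p)
      σ-joins p = proj₂ (proj₂ (secant u∈S p))

      σ-involutive : ∀ p → σ (σ p) ≡ p
      σ-involutive p = joins-unique u∈S (σ-moves (σ p)) (σ-moves p ∘ sym) (σ-joins (σ p))
                         (trans (cong ⟨ u ,_⟩ (+-comm (H (σ p)) (H p))) (σ-joins p))

      ⟨⟩-σ : ∀ p → ⟨ u , H (σ p) ⟩ ≡ ⟨ u , H p ⟩
      ⟨⟩-σ p = sym (sum≡0⇒≡ (trans (sym (⟨⟩-+ u (H p) (H (σ p)))) (σ-joins p)))

    pairing-sum : ∀ {u} → InS u → (φ : Carrier → Carrier) → sumF (suc (suc q)) (λ p → φ ⟨ u , H p ⟩) ≡ 0#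
    pairing-sum u∈S φ = involution-sum _ _ σ σ-involutive σ-moves (λ p → cong φ (⟨⟩-σ p))
      where open Pairing u∈S

    base-direction² : Fin (suc q) → Carrier
    base-direction² j = chord-direction Fin.zero (Fin.suc j) (λ ()) ^ 2

    base-direction²-injective : Injective _≡_ _≡_ base-direction²
    base-direction²-injective {i} {j} dᵢ²≡dⱼ² = Finₚ.suc-injective
      (joins-unique (chord-direction∈S Fin.zero (Fin.suc i) (λ ())) (λ ()) (λ ())
        (chord-direction-joins Fin.zero (Fin.suc i) (λ ()))
        (subst (λ v → Joins v Fin.zero (Fin.suc j)) (sym (square-injective dᵢ²≡dⱼ²))
          (chord-direction-joins Fin.zero (Fin.suc j) (λ ()))))

    -- The polynomial
    -- P(v) = Σ_p (H p + conj (H p) v) ^ k has degree ≤ k ≤ q; at v = u² with u ∈ S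
    -- its terms are (u ⟨ u , H p ⟩) ^ k, so P(u²) = 0 by the pairing. The q + 1
    -- squared chord directions at H 0 are thus roots, forcing P = 0; and P(0)
    -- is the power sum.
    power-sums-vanish : ∀ k → k ℕ.≤ q → sumF (suc (suc q)) (λ p → H p ^ k) ≡ 0#
    power-sums-vanish k k≤q = trans (sym P-at-0)
      (root-bound (suc q) P-poly base-direction² base-direction²-injective P-roots 0#)
      where
        P : Carrier → Carrier
        P v = sumF (suc (suc q)) (λ p → (H p + conj (H p) * v) ^ k)
        P-poly : PolyFun (suc q) P
        P-poly = polyFun-sum _ _ (λ p → polyFun-weaken (s≤s k≤q) (polyFun-^ (conj (H p)) (H p) k))
        P-at-0 : P 0# ≡ sumF (suc (suc q)) (λ p → H p ^ k)
        P-at-0 = sumF-cong (λ p → cong (_^ k) (trans (cong (H p +_) (zeroʳ (conj (H p)))) (+-identityʳ (H p))))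
        P-vanishes-on-S² : ∀ {u} → InS u → P (u ^ 2) ≡ 0#
        P-vanishes-on-S² {u} u∈S = trans (sumF-cong term) (pairing-sum u∈S (λ t → (u * t) ^ k))
          where
            open ≡-Reasoning
            term : ∀ p → (H p + conj (H p) * u ^ 2) ^ k ≡ (u * ⟨ u , H p ⟩) ^ k
            term p = cong (_^ k) (begin
              H p + conj (H p) * u ^ 2    ≡⟨ cong (H p +_) (*-comm _ _) ⟩
              H p + u ^ 2 * conj (H p)    ≡⟨ S-form (H p) u∈S ⟨
              u * ⟨ u , H p ⟩             ∎)
        P-roots : ∀ j → P (base-direction² j) ≡ 0#
        P-roots j = P-vanishes-on-S² (chord-direction∈S Fin.zero (Fin.suc j) (λ ()))

open import Data.Nat using (ℕ; suc; _^_; _*_)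
open import Data.Fin using (Fin)
open import Relation.Binary.PropositionalEquality using (_≡_)

-- Indeed O ∪ {0}
-- is a hyperoval, so for 1 ≤ k ≤ q its k-th power sum 0 ^ k + Σ y ^ k vanishes.
-- (For m = 0 the field would have a single element, which is impossible.)
lemma3p4 : (m : ℕ) (K : FiniteField) →
    FiniteField.size K ≡ (2 ^ m) * (2 ^ m) →
    (y : Fin (suc (2 ^ m)) → FiniteField.Carrier K) →
    Plane.IsOvalWithNucleus0 K (2 ^ m) y →
    Plane.IsSuperVandermonde K (2 ^ m) (suc (2 ^ m)) y
lemma3p4 zero K size≡1 y _ = ⊥-elim (FieldTheory.size≢1 K size≡1)
lemma3p4 (suc m) K size≡q² y (_ , _ , hyperoval) (suc k) _ (s≤s k≤q) = begin
    sumF (suc q) (λ i → y i ^ᴷ suc k)               ≡⟨ +-identityˡ _ ⟨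
    0# + sumF (suc q) (λ i → y i ^ᴷ suc k)          ≡⟨ cong (_+ sumF (suc q) (λ i → y i ^ᴷ suc k)) (zeroˡ _) ⟨
    0# ^ᴷ suc k + sumF (suc q) (λ i → y i ^ᴷ suc k) ≡⟨ power-sums-vanish (suc k) k≤q ⟩
    0#                                             ∎
  where
    open ≡-Reasoning
    open FieldTheory K using (sumF; 0#; _+_; +-identityˡ; zeroˡ) renaming (_^_ to _^ᴷ_)
    open UnitaryPlane K m size≡q² using (q; module Hyperoval)
    open Hyperoval (Plane.withNucleus K q y) hyperoval using (power-sums-vanish)
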